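{- Suppose that for every numerical semigroup $\Gamma\neq\mathbb{N}$ the inequality \[ \min_{g\in\mathbb{N}\setminus\Gamma}W(g)\ \ge\ -W_\Gamma(e(\Gamma)) \] holds. Then every numerical semigroup $\Gamma$ satisfies $c(\Gamma)\le e(\Gamma)\,\delta(\Gamma)$ (i.e. the Wilf conjecture holds).
   Context: A numerical semigroup is an additive submonoid $\Gamma\subseteq\mathbb{N}$ with finite complement; its elements not in $\Gamma$ are gaps, and $e(\Gamma)$ is the cardinality of its minimal generating set. For $\Delta\subseteq\mathbb{N}$ with finite complement, $c(\Delta)$ is one more than the largest element of $\mathbb{N}\setminus\Delta$ and $\delta(\Delta)=|\{x\in\Delta:x<c(\Delta)\}|$. $W_\Gamma(k)=k\delta(\Gamma)-c(\Gamma)$. For a gap $g$, let $\Delta_g=\Gamma\cup(g+\Gamma)$ (the $\Gamma$-semimodule minimally generated by $\{0,g\}$) and $W(g)=2\delta(\Delta_g)-c(\Delta_g)$. -}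

module Defs where

open import Data.Bool using (Bool; true; false; if_then_else_; _∧_; _∨_; not)
open import Data.Nat using (ℕ; zero; suc; _+_; _*_; _∸_; _≤_; _<_; _≤ᵇ_; _≡ᵇ_)
open import Data.Integer as ℤ using (ℤ; +_)
open import Data.Product using (∃)
open import Relation.Binary.PropositionalEquality using (_≡_)

record NumericalSemigroup : Set where
  field
    mem      : ℕ → Bool
    zero∈    : mem 0 ≡ true
    closed   : ∀ a b → mem a ≡ true → mem b ≡ true → mem (a + b) ≡ true
    bound    : ℕ
    cofinite : ∀ n → bound ≤ n → mem n ≡ true
open NumericalSemigroup public

-- cond D N : for D ⊆ ℕ containing every n ≥ N, this is one more than the
-- largest element of ℕ ∖ D (and 0 if there is none), i.e. the conductor c(D).
-- (Its value does not depend on the choice of such N.)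
cond : (ℕ → Bool) → ℕ → ℕ
cond D zero    = zero
cond D (suc n) = if D n then cond D n else suc n

count : (ℕ → Bool) → ℕ → ℕ
count D zero    = zero
count D (suc n) = count D n + (if D n then 1 else 0)

deltaOf : (ℕ → Bool) → ℕ → ℕ
deltaOf D N = count D (cond D N)

c : NumericalSemigroup → ℕ
c Γ = cond (mem Γ) (bound Γ)

δ : NumericalSemigroup → ℕ
δ Γ = deltaOf (mem Γ) (bound Γ)

-- isSum D x : does x = a + b with a, b ∈ D, a ≥ 1, b ≥ 1 ?
-- (checks a = 1, …, x-1 with b = x - a)
isSumAux : (ℕ → Bool) → ℕ → ℕ → Bool
isSumAux D x zero    = false
isSumAux D x (suc a) =
  ((not (a ≡ᵇ 0)) ∧ (D a ∧ D (x ∸ a))) ∨ isSumAux D x a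

isSum : (ℕ → Bool) → ℕ → Bool
isSum D x = isSumAux D x x

isMinGen : NumericalSemigroup → ℕ → Bool
isMinGen Γ x = mem Γ x ∧ (not (x ≡ᵇ 0) ∧ not (isSum (mem Γ) x))

-- e(Γ) = number of minimal generators.  All minimal generators are < c + m
-- ≤ 2c + 1 (m = multiplicity), so counting below 2c+1 counts all of them.
e : NumericalSemigroup → ℕ
e Γ = count (isMinGen Γ) (suc (2 * c Γ))

WΓ : NumericalSemigroup → ℕ → ℤ
WΓ Γ k = + (k * δ Γ) ℤ.- + c Γ

Δmem : NumericalSemigroup → ℕ → ℕ → Bool
Δmem Γ g x = mem Γ x ∨ ((g ≤ᵇ x) ∧ mem Γ (x ∸ g))

-- Δ_g ⊇ Γ, so bound Γ is also a cofiniteness bound for Δ_g.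
cΔ : NumericalSemigroup → ℕ → ℕ
cΔ Γ g = cond (Δmem Γ g) (bound Γ)

δΔ : NumericalSemigroup → ℕ → ℕ
δΔ Γ g = deltaOf (Δmem Γ g) (bound Γ)

W : NumericalSemigroup → ℕ → ℤ
W Γ g = + (2 * δΔ Γ g) ℤ.- + cΔ Γ g

NotAll : NumericalSemigroup → Set
NotAll Γ = ∃ λ n → mem Γ n ≡ false

-- Apply the hypothesis at the Frobenius number F = c(Γ) - 1.  Every n ≥ F lies
-- in Δ_F = Γ ∪ (F + Γ), so its conductor k is at most F, and below F it agrees
-- with Γ.  Hence no x, y ∈ Δ_F satisfy x + y = k - 1: otherwise k - 1 ∈ Γ ⊆ Δ_F.
-- So at most half of [0, k) lies in Δ_F, i.e. W(F) = 2 δ(Δ_F) - k ≤ 0, and the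
-- hypothesis -W_Γ(e) ≤ W(F) gives e δ - c ≥ 0.
module Submission where

open import Defs
open import Algebra.Properties.CommutativeSemigroup using (interchange)
open import Data.Bool using (Bool; true; false; if_then_else_; T)
open import Data.Bool.Properties using (∨-zeroʳ; T-≡)
open import Data.Nat using (ℕ; zero; suc; _*_; _≤_; _<_; _+_; _∸_; z≤n; _≤ᵇ_; _≤?_; s≤s⁻¹)
open import Data.Nat.Properties
open import Data.Integer as ℤ using ()
import Data.Integer.Properties as ℤP
open import Data.Product using (_,_)
open import Data.Sum using (inj₁; inj₂)
open import Function using (_∘_)
open import Function.Bundles using (Equivalence)
open import Relation.Nullary using (yes; no; contradiction)
open import Relation.Binary.PropositionalEquality

bit : Bool → ℕ
bit b = if b then 1 else 0

bit≤1 : ∀ b → bit b ≤ 1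
bit≤1 true  = ≤-refl
bit≤1 false = z≤n

count-cong : ∀ D E n → (∀ x → x < n → D x ≡ E x) → count D n ≡ count E n
count-cong D E zero    D≗E = refl
count-cong D E (suc n) D≗E =
  cong₂ _+_ (count-cong D E n (λ x x<n → D≗E x (m≤n⇒m≤1+n x<n))) (cong bit (D≗E n ≤-refl))

count-suc-shift : ∀ D n → count D (suc n) ≡ bit (D 0) + count (λ x → D (suc x)) n
count-suc-shift D zero    = +-comm 0 (bit (D 0))
count-suc-shift D (suc n) =
  trans (cong (_+ bit (D (suc n))) (count-suc-shift D n)) (+-assoc (bit (D 0)) _ _)

count-reverse : ∀ D n → count (λ x → D (n ∸ suc x)) n ≡ count D n
count-reverse D zero    = refl
count-reverse D (suc n) = begin
  count (λ x → D (n ∸ x)) n + bit (D (n ∸ n))   ≡⟨ cong₂ _+_ reflect-shifted (cong (bit ∘ D) (n∸n≡0 n)) ⟩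
  count (λ x → D (suc x)) n + bit (D 0)         ≡⟨ +-comm _ (bit (D 0)) ⟩
  bit (D 0) + count (λ x → D (suc x)) n         ≡⟨ count-suc-shift D n ⟨
  count D (suc n)                               ∎
  where
  open ≡-Reasoning
  reflect-shifted : count (λ x → D (n ∸ x)) n ≡ count (λ x → D (suc x)) n
  reflect-shifted =
    trans (count-cong _ (λ x → D (suc (n ∸ suc x))) n (λ x x<n → cong D (+-∸-assoc 1 x<n)))
          (count-reverse (λ x → D (suc x)) n)

count-disjoint : ∀ D E n → (∀ x → x < n → D x ≡ true → E x ≡ false) →
                 count D n + count E n ≤ n
count-disjoint D E zero    _        = z≤n
count-disjoint D E (suc n) disjoint = begin
  count D n + bit (D n) + (count E n + bit (E n))   ≡⟨ interchange +-commutativeSemigroup (count D n) (bit (D n)) (count E n) (bit (E n)) ⟩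
  count D n + count E n + (bit (D n) + bit (E n))   ≤⟨ +-mono-≤ below-n at-n ⟩
  n + 1                                             ≡⟨ +-comm n 1 ⟩
  suc n                                             ∎
  where
  open ≤-Reasoning
  below-n : count D n + count E n ≤ n
  below-n = count-disjoint D E n (λ x x<n → disjoint x (m≤n⇒m≤1+n x<n))
  at-n : bit (D n) + bit (E n) ≤ 1
  at-n with D n in Dn
  ... | true  rewrite disjoint n ≤-refl Dn = ≤-refl
  ... | false = bit≤1 (E n)

-- The reflection x ↦ k - 1 - x sends D ∩ [0, k) into the complement of D.
2*count≤ : ∀ D k → (∀ x → x < k → D x ≡ true → D (k ∸ suc x) ≡ false) → 2 * count D k ≤ k
2*count≤ D k pair-free = begin
  count D k + (count D k + 0)                    ≡⟨ cong (count D k +_) (+-identityʳ _) ⟩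
  count D k + count D k                          ≡⟨ cong (count D k +_) (count-reverse D k) ⟨
  count D k + count (λ x → D (k ∸ suc x)) k      ≤⟨ count-disjoint D _ k pair-free ⟩
  k                                              ∎
  where open ≤-Reasoning

cond≤ : ∀ D N M → (∀ n → M ≤ n → D n ≡ true) → cond D N ≤ M
cond≤ D zero    M above = z≤n
cond≤ D (suc N) M above with D N in DN
... | true  = cond≤ D N M above
... | false with M ≤? N
...   | yes M≤N = contradiction (trans (sym DN) (above N M≤N)) λ ()
...   | no  M≰N = ≰⇒> M≰N

cond≡suc⇒∉ : ∀ D N f → cond D N ≡ suc f → D f ≡ false
cond≡suc⇒∉ D (suc N) f c≡ with D N in DN
... | true  = cond≡suc⇒∉ D N f c≡
... | false with refl ← c≡ = DN

cond-cofinite : ∀ D N → (∀ n → N ≤ n → D n ≡ true) → ∀ n → cond D N ≤ n → D n ≡ true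
cond-cofinite D zero    above n _ = above n z≤n
cond-cofinite D (suc N) above n c≤n with D N in DN
... | false = above n c≤n
... | true  = cond-cofinite D N above-N n c≤n
  where
  above-N : ∀ m → N ≤ m → D m ≡ true
  above-N m N≤m with m≤n⇒m<n∨m≡n N≤m
  ... | inj₁ N<m  = above m N<m
  ... | inj₂ refl = DN

frobenius-∉ : ∀ Γ {F} → c Γ ≡ suc F → mem Γ F ≡ false
frobenius-∉ Γ {F} = cond≡suc⇒∉ (mem Γ) (bound Γ) F

>frobenius-∈ : ∀ Γ {F} → c Γ ≡ suc F → ∀ n → F < n → mem Γ n ≡ true
>frobenius-∈ Γ c≡ n F<n =
  cond-cofinite (mem Γ) (bound Γ) (cofinite Γ) n (subst (_≤ n) (sym c≡) F<n)

Γ⊆Δ : ∀ Γ g {x} → mem Γ x ≡ true → Δmem Γ g x ≡ true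
Γ⊆Δ Γ g x∈Γ rewrite x∈Γ = refl

g+Γ⊆Δ : ∀ Γ g {x} → mem Γ x ≡ true → Δmem Γ g (g + x) ≡ true
g+Γ⊆Δ Γ g {x} x∈Γ
  rewrite m+n∸m≡n g x | x∈Γ | Equivalence.to T-≡ (≤⇒≤ᵇ (m≤m+n g x)) = ∨-zeroʳ (mem Γ (g + x))

Δ-below : ∀ Γ g x → x < g → Δmem Γ g x ≡ true → mem Γ x ≡ true
Δ-below Γ g x x<g x∈Δ with mem Γ x | g ≤ᵇ x in g≤ᵇx
... | true  | _     = refl
... | false | true  = contradiction (≤ᵇ⇒≤ g x (subst T (sym g≤ᵇx) _)) (<⇒≱ x<g)
... | false | false = x∈Δ

module Frobenius (Γ : NumericalSemigroup) {F : ℕ} (c≡ : c Γ ≡ suc F) where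

  Δ : ℕ → Bool
  Δ = Δmem Γ F

  ≥frobenius-∈Δ : ∀ n → F ≤ n → Δ n ≡ true
  ≥frobenius-∈Δ n F≤n with m≤n⇒m<n∨m≡n F≤n
  ... | inj₁ F<n  = Γ⊆Δ Γ F (>frobenius-∈ Γ c≡ n F<n)
  ... | inj₂ refl = subst (λ m → Δ m ≡ true) (+-identityʳ F) (g+Γ⊆Δ Γ F (zero∈ Γ))

  cΔ≤F : cΔ Γ F ≤ F
  cΔ≤F = cond≤ Δ (bound Γ) F ≥frobenius-∈Δ

  Δ-pair-free : ∀ x → x < cΔ Γ F → Δ x ≡ true → Δ (cΔ Γ F ∸ suc x) ≡ false
  Δ-pair-free x x<k x∈Δ with cΔ Γ F in k≡
  ... | suc f with Δ (f ∸ x) in f∸x∈Δ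
  ...   | false = refl
  ...   | true  = contradiction (trans (sym (cond≡suc⇒∉ Δ (bound Γ) f k≡)) (Γ⊆Δ Γ F f∈Γ)) λ ()
    where
    f<F : f < F
    f<F = subst (_≤ F) k≡ cΔ≤F
    x≤f : x ≤ f
    x≤f = s≤s⁻¹ x<k
    f∈Γ : mem Γ f ≡ true
    f∈Γ = subst (λ m → mem Γ m ≡ true) (m+[n∸m]≡n x≤f)
            (closed Γ x (f ∸ x) (Δ-below Γ F x (≤-<-trans x≤f f<F) x∈Δ)
                                (Δ-below Γ F (f ∸ x) (≤-<-trans (m∸n≤m f x) f<F) f∸x∈Δ))

  W≤0 : W Γ F ℤ.≤ ℤ.0ℤ
  W≤0 = ℤP.i≤j⇒i-j≤0 (ℤ.+≤+ (2*count≤ Δ (cΔ Γ F) Δ-pair-free))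

-W≤0⇒c≤kδ : ∀ Γ k → ℤ.- WΓ Γ k ℤ.≤ ℤ.0ℤ → c Γ ≤ k * δ Γ
-W≤0⇒c≤kδ Γ k -W≤0 = ℤP.drop‿+≤+ (ℤP.0≤i-j⇒j≤i (ℤP.neg-cancel-≤ -W≤0))

theorem4p10 : (∀ (Γ : NumericalSemigroup) → NotAll Γ →
    ∀ (g : ℕ) → mem Γ g ≡ false → W Γ g ℤ.≥ ℤ.- WΓ Γ (e Γ)) →
    ∀ (Γ : NumericalSemigroup) → c Γ ≤ e Γ * δ Γ
theorem4p10 hyp Γ = by-conductor (c Γ) refl
  where
  by-conductor : ∀ n → c Γ ≡ n → c Γ ≤ e Γ * δ Γ
  by-conductor zero    c≡0 = subst (_≤ e Γ * δ Γ) (sym c≡0) z≤n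
  by-conductor (suc F) c≡  =
    -W≤0⇒c≤kδ Γ (e Γ) (ℤP.≤-trans (hyp Γ (F , F∉Γ) F F∉Γ) (Frobenius.W≤0 Γ c≡))
    where
    F∉Γ : mem Γ F ≡ false
    F∉Γ = frobenius-∉ Γ c≡
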